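{- Consider the \textsc{Normal Domination Game} and let $n\geq 0$. The nimbers of the paths $P_1$, $P_2$ and $P_3$ are $1$, $1$ and $2$, respectively. Moreover, if $n\geq 4$, then the nimber of $P_n$ is $0$, $1$, $1$ or $3$ according as $n \bmod 4$ is $0$, $1$, $2$ or $3$, respectively. Consequently, Bob (the second player) wins the \textsc{Normal Domination Game} on the path $P_n$ if and only if $n$ is a multiple of $4$.
   Context: $P_n$ is the path with vertices $v_1,\dots,v_n$ and edges $v_1v_2,\dots,v_{n-1}v_n$. A vertex dominates itself and its neighbors. In the \textsc{Normal Domination Game} on a graph $G$, Alice (first) and Bob alternately select playable vertices, where a vertex is playable if it dominates at least one vertex not dominated by previously selected vertices; the game ends when no vertex is playable, and the last player to move wins. This is an impartial game. The nimber (Sprague–Grundy value) of a position is defined recursively as the minimum excludant $\mathrm{mex}$ (least non-negative integer not in the set) of the set of nimbers of the positions reachable in one move; a position with no moves has nimber $0$. The first player wins from a position iff its nimber is nonzero. -}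

module Defs where

open import Data.Nat using (ℕ; zero; suc; _+_; _≡ᵇ_; _≤ᵇ_)
open import Data.Bool using (Bool; true; false; _∧_; _∨_; not; if_then_else_)
open import Data.Fin using (Fin; toℕ)
open import Data.List using (List; []; _∷_; map; filter; length; upTo)
open import Data.Bool.ListAction using (any)
open import Relation.Binary.PropositionalEquality using (_≡_)
open import Data.List.Base using (allFin)
open import Relation.Nullary.Decidable using (does)
open import Data.Bool.Properties using (T?)
open import Data.Fin using (Fin)

-- Path P_n: vertices Fin n (v_1..v_n ↦ 0..n-1), u ~ w iff |u - w| = 1.
-- Closed neighbourhood test: u dominates w iff |toℕ u - toℕ w| ≤ 1.
dominatesP : ∀ {n} → Fin n → Fin n → Bool
dominatesP u w = (toℕ u ≤ᵇ suc (toℕ w)) ∧ (toℕ w ≤ᵇ suc (toℕ u))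

-- A position is the set of vertices dominated so far (characteristic function).
Position : ℕ → Set
Position n = Fin n → Bool

playable : ∀ {n} → Position n → Fin n → Bool
playable {n} D v = any (λ w → dominatesP v w ∧ not (D w)) (allFin n)

play : ∀ {n} → Position n → Fin n → Position n
play D v w = D w ∨ dominatesP v w

memberℕ : ℕ → List ℕ → Bool
memberℕ k xs = any (λ x → k ≡ᵇ x) xs

firstNotIn : List ℕ → List ℕ → ℕ
firstNotIn xs [] = length xs
firstNotIn xs (k ∷ ks) = if memberℕ k xs then firstNotIn xs ks else k

mex : List ℕ → ℕ
mex xs = firstNotIn xs (upTo (suc (length xs)))

-- Every move dominates at least one new vertex, so from any position of
-- P_n at most n moves remain; fuel n is therefore exact from the start.
nimberFuel : ∀ {n} → ℕ → Position n → ℕ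
nimberFuel zero D = 0
nimberFuel {n} (suc k) D =
  mex (map (λ v → nimberFuel k (play D v))
           (filter (λ v → T? (playable D v)) (allFin n)))

start : ∀ {n} → Position n
start _ = false

nimberPath : ℕ → ℕ
nimberPath n = nimberFuel {n} n start

-- Bob (second player) wins iff the nimber is 0 (Sprague–Grundy).
BobWins : ℕ → Set
BobWins n = nimberPath n ≡ 0

{-# OPTIONS --safe #-}
-- Record a position of P_n as the list of its vertices, true meaning dominated. No reachable
-- position has a dominated vertex between two undominated ones, and as soon as some vertex is
-- dominated, the nimber of the position is the nim-sum of the lengths mod 4 of its maximal runs
-- of undominated vertices. Indeed, because of that invariant a move either dominates one or two
-- vertices at an end of a single run or three consecutive vertices of it, and none of these
-- changes preserves the nim-sum; conversely, to reach a smaller value t from the value g, shorten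
-- at one end by 1, 2 or 3 vertices a run whose length has the top bit of g ⊕ t set, as in Nim.
-- The first move in P_n leaves runs of lengths a and b with a + b + 3 = n, or a single run of
-- length n - 2, and comparing these values in each residue class of n mod 4 gives the theorem.
module Submission where

open import Defs
open import Data.Bool using (Bool; true; false; _∧_; _∨_; not; _xor_; if_then_else_)
import Data.Bool as Bool
open import Data.Bool.ListAction using (or)
open import Data.Bool.Properties using (∨-identityʳ; ∨-zeroʳ; T-≡; T?)
open import Data.Empty using (⊥-elim)
open import Data.Fin using (Fin; toℕ; fromℕ<; _≟_) renaming (_<_ to _<ᶠ_)
import Data.Fin as Fin
open import Data.Fin.Patterns using (0F; 1F; 2F; 3F)
open import Data.Fin.Properties using (all?; _<?_; pigeonhole; toℕ<n; toℕ-injective; toℕ-fromℕ<)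
open import Data.List
  using (List; []; _∷_; _++_; _∷ʳ_; replicate; length; lookup; applyUpTo; tabulate; map; filter; allFin)
open import Data.List.Membership.Propositional using (_∈_; _∉_)
open import Data.List.Membership.Propositional.Properties
  using (∈-map⁺; ∈-map⁻; ∈-filter⁺; ∈-filter⁻; ∈-allFin)
open import Data.List.Properties
  using (++-assoc; ++-identityʳ; length-++; length-replicate; length-tabulate; map-tabulate; tabulate-cong;
         ∷-injective; ∷ʳ-injective)
open import Data.List.Relation.Unary.Any using (here; there)
import Data.List.Relation.Unary.Any as Any
open import Data.List.Relation.Unary.Any.Properties using (any⁺; any⁻; lookup-index)
open import Data.List.Reverse using (reverseView; []; _∶_∶ʳ_)
open import Data.Nat
  using (ℕ; zero; suc; _+_; _≤_; _<_; z≤n; s≤s; z<s; s≤s⁻¹; s<s⁻¹; _≤ᵇ_; _<ᵇ_; _%_)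
import Data.Nat as ℕ
open import Data.Nat.Divisibility using (_∣_; _∣0; m%n≡0⇒n∣m; n∣m⇒m%n≡0)
open import Data.Nat.Properties
  using (+-suc; +-comm; +-identityʳ; ≤-reflexive; ≤-trans; <-trans; <-irrefl; <⇒≢; ≮⇒≥; m≤n⇒m≤1+n;
         m≤n⇒∃[o]m+o≡n; ≡ᵇ⇒≡; ≡⇒≡ᵇ)
open import Data.Product using (∃-syntax; _×_; _,_; proj₁; proj₂)
open import Data.Sum using (_⊎_; inj₁; inj₂)
open import Data.Unit using (⊤; tt)
open import Function using (id; _∘_)
open import Function.Bundles using (Equivalence; _⇔_; mk⇔)
open import Relation.Binary.PropositionalEquality
open import Relation.Nullary using (¬_; Dec)
open import Relation.Nullary.Decidable using (True; toWitness; from-yes; ¬?; _→-dec_; _⊎-dec_)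
open ≡-Reasoning

-- Nim-sums of residues mod 4

infixl 6 _⊕_ _+₄_

_⊕_ : Fin 4 → Fin 4 → Fin 4
0F ⊕ b  = b
1F ⊕ 0F = 1F
1F ⊕ 1F = 0F
1F ⊕ 2F = 3F
1F ⊕ 3F = 2F
2F ⊕ 0F = 2F
2F ⊕ 1F = 3F
2F ⊕ 2F = 0F
2F ⊕ 3F = 1F
3F ⊕ 0F = 3F
3F ⊕ 1F = 2F
3F ⊕ 2F = 1F
3F ⊕ 3F = 0F

residue : ℕ → Fin 4
residue 0 = 0F
residue 1 = 1F
residue 2 = 2F
residue 3 = 3F
residue (suc (suc (suc (suc n)))) = residue n

_+₄_ : Fin 4 → Fin 4 → Fin 4
a +₄ b = residue (toℕ a + toℕ b)

⊕-identityʳ : ∀ a → a ⊕ 0F ≡ a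
⊕-identityʳ = from-yes (all? λ a → a ⊕ 0F ≟ a)

⊕-assoc : ∀ a b c → a ⊕ b ⊕ c ≡ a ⊕ (b ⊕ c)
⊕-assoc = from-yes (all? λ a → all? λ b → all? λ c → a ⊕ b ⊕ c ≟ a ⊕ (b ⊕ c))

⊕-cancelˡ : ∀ a b c → a ⊕ b ≡ a ⊕ c → b ≡ c
⊕-cancelˡ = from-yes (all? λ a → all? λ b → all? λ c → (a ⊕ b ≟ a ⊕ c) →-dec (b ≟ c))

⊕-cancelʳ : ∀ a b c → b ⊕ a ≡ c ⊕ a → b ≡ c
⊕-cancelʳ = from-yes (all? λ a → all? λ b → all? λ c → (b ⊕ a ≟ c ⊕ a) →-dec (b ≟ c))

residue-toℕ : ∀ a → residue (toℕ a) ≡ a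
residue-toℕ = from-yes (all? λ a → residue (toℕ a) ≟ a)

+₄-assoc : ∀ a b c → a +₄ b +₄ c ≡ a +₄ (b +₄ c)
+₄-assoc = from-yes (all? λ a → all? λ b → all? λ c → a +₄ b +₄ c ≟ a +₄ (b +₄ c))

residue-suc : ∀ n → residue (suc n) ≡ 1F +₄ residue n
residue-suc 0 = refl
residue-suc 1 = refl
residue-suc 2 = refl
residue-suc 3 = refl
residue-suc (suc (suc (suc (suc n)))) = residue-suc n

residue-+ : ∀ m n → residue (m + n) ≡ residue m +₄ residue n
residue-+ zero    n = sym (residue-toℕ (residue n))
residue-+ (suc m) n = begin
  residue (suc (m + n))            ≡⟨ residue-suc (m + n) ⟩
  1F +₄ residue (m + n)            ≡⟨ cong (1F +₄_) (residue-+ m n) ⟩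
  1F +₄ (residue m +₄ residue n)   ≡⟨ +₄-assoc 1F (residue m) (residue n) ⟨
  1F +₄ residue m +₄ residue n     ≡⟨ cong (_+₄ residue n) (residue-suc m) ⟨
  residue (suc m) +₄ residue n     ∎

-- The value of a position

runValue : ℕ → List Bool → Fin 4
runValue c []           = residue c
runValue c (true ∷ xs)  = residue c ⊕ runValue 0 xs
runValue c (false ∷ xs) = runValue (suc c) xs

value : List Bool → Fin 4
value = runValue 0

runValue-++-∷ : ∀ c xs ys → runValue c (xs ++ true ∷ ys) ≡ runValue c xs ⊕ value ys
runValue-++-∷ c []           ys = refl
runValue-++-∷ c (false ∷ xs) ys = runValue-++-∷ (suc c) xs ys
runValue-++-∷ c (true ∷ xs)  ys = begin
  residue c ⊕ runValue 0 (xs ++ true ∷ ys)  ≡⟨ cong (residue c ⊕_) (runValue-++-∷ 0 xs ys) ⟩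
  residue c ⊕ (value xs ⊕ value ys)         ≡⟨ ⊕-assoc (residue c) (value xs) (value ys) ⟨
  residue c ⊕ value xs ⊕ value ys           ∎

value-++-∷ : ∀ xs ys → value (xs ++ true ∷ ys) ≡ value xs ⊕ value ys
value-++-∷ = runValue-++-∷ 0

value-∷ʳ-true : ∀ xs → value (xs ∷ʳ true) ≡ value xs
value-∷ʳ-true xs = trans (value-++-∷ xs []) (⊕-identityʳ (value xs))

runValue-replicate : ∀ c r → runValue c (replicate r false) ≡ residue (r + c)
runValue-replicate c zero    = refl
runValue-replicate c (suc r) = trans (runValue-replicate (suc c) r) (cong residue (+-suc r c))

value-replicate : ∀ m → value (replicate m false) ≡ residue m
value-replicate m = trans (runValue-replicate 0 m) (cong residue (+-identityʳ m))

value-replicate-++-∷ : ∀ m q → value (replicate m false ++ true ∷ q) ≡ residue m ⊕ value q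
value-replicate-++-∷ m q = trans (value-++-∷ (replicate m false) q) (cong (_⊕ value q) (value-replicate m))

value-run : ∀ p L q →
  value (p ++ true ∷ replicate L false ++ true ∷ q) ≡ value p ⊕ (residue L ⊕ value q)
value-run p L q = trans (value-++-∷ p _) (cong (value p ⊕_) (value-replicate-++-∷ L q))

value-trimmed : ∀ pre m q →
  value (pre ++ true ∷ true ∷ true ∷ replicate m false ++ true ∷ q) ≡ value pre ⊕ (residue m ⊕ value q)
value-trimmed pre m q = trans (value-++-∷ pre _) (cong (value pre ⊕_) (value-replicate-++-∷ m q))

runValue-residue : ∀ {c d} xs → residue c ≡ residue d → runValue c xs ≡ runValue d xs
runValue-residue          []           eq = eq
runValue-residue          (true ∷ xs)  eq = cong (_⊕ value xs) eq
runValue-residue {c} {d} (false ∷ xs) eq = runValue-residue xs (begin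
  residue (suc c)    ≡⟨ residue-suc c ⟩
  1F +₄ residue c    ≡⟨ cong (1F +₄_) eq ⟩
  1F +₄ residue d    ≡⟨ residue-suc d ⟨
  residue (suc d)    ∎)

runValue-replicateʳ : ∀ {r s} c xs → residue r ≡ residue s →
                      runValue c (xs ++ replicate r false) ≡ runValue c (xs ++ replicate s false)
runValue-replicateʳ {r} {s} c [] eq = begin
  runValue c (replicate r false)  ≡⟨ runValue-replicate c r ⟩
  residue (r + c)                 ≡⟨ residue-+ r c ⟩
  residue r +₄ residue c          ≡⟨ cong (_+₄ residue c) eq ⟩
  residue s +₄ residue c          ≡⟨ residue-+ s c ⟨
  residue (s + c)                 ≡⟨ runValue-replicate c s ⟨
  runValue c (replicate s false)  ∎
runValue-replicateʳ c (true ∷ xs)  eq = cong (residue c ⊕_) (runValue-replicateʳ 0 xs eq)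
runValue-replicateʳ c (false ∷ xs) eq = runValue-replicateʳ (suc c) xs eq

runValue-prefix : ∀ c pre → ∃[ a ] ∃[ l ] ∀ ys → runValue c (pre ++ ys) ≡ a ⊕ runValue l ys
runValue-prefix c []            = 0F , c , λ _ → refl
runValue-prefix c (false ∷ pre) = runValue-prefix (suc c) pre
runValue-prefix c (true ∷ pre) with runValue-prefix 0 pre
... | a , l , eq = residue c ⊕ a , l , λ ys →
  trans (cong (residue c ⊕_) (eq ys)) (sym (⊕-assoc (residue c) a (runValue l ys)))

runValue-suffix : ∀ post → ∃[ r ] ∃[ b ] ∀ c xs →
  runValue c (xs ++ post) ≡ runValue c (xs ++ replicate r false) ⊕ b
runValue-suffix []            = 0 , 0F , λ c xs → sym (⊕-identityʳ _)
runValue-suffix (true ∷ post) = 0 , value post , λ c xs →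
  trans (runValue-++-∷ c xs post) (cong (λ ys → runValue c ys ⊕ value post) (sym (++-identityʳ xs)))
runValue-suffix (false ∷ post) with runValue-suffix post
... | r , b , eq = suc r , b , λ c xs → begin
  runValue c (xs ++ false ∷ post)                           ≡⟨ cong (runValue c) (++-assoc xs _ post) ⟨
  runValue c ((xs ∷ʳ false) ++ post)                        ≡⟨ eq c (xs ∷ʳ false) ⟩
  runValue c ((xs ∷ʳ false) ++ replicate r false) ⊕ b       ≡⟨ cong (_⊕ b) (cong (runValue c) (++-assoc xs _ _)) ⟩
  runValue c (xs ++ replicate (suc r) false) ⊕ b            ∎

flankedValue : ℕ → List Bool → ℕ → Fin 4
flankedValue l w r = runValue l (w ++ replicate r false)

window-value : ∀ pre post → ∃[ a ] ∃[ l ] ∃[ r ] ∃[ b ] ∀ w →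
  value (pre ++ w ++ post) ≡ a ⊕ (flankedValue l w r ⊕ b)
window-value pre post with runValue-prefix 0 pre | runValue-suffix post
... | a , l , eqˡ | r , b , eqʳ = a , l , r , b , λ w → trans (eqˡ (w ++ post)) (cong (a ⊕_) (eqʳ l w))

-- Moves as windows of the padded position

near : ℕ → ℕ → Bool
near i j = (i ≤ᵇ suc j) ∧ (j ≤ᵇ suc i)

-- The list counterparts of play and playable, for a list whose first entry has index p.
dominateFrom : ℕ → ℕ → List Bool → List Bool
dominateFrom i p []       = []
dominateFrom i p (x ∷ xs) = (x ∨ near i p) ∷ dominateFrom i (suc p) xs

playableFrom : ℕ → ℕ → List Bool → Bool
playableFrom i p []       = false
playableFrom i p (x ∷ xs) = (near i p ∧ not x) ∨ playableFrom i (suc p) xs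

dominate : ℕ → List Bool → List Bool
dominate i = dominateFrom i 0

playableAt : ℕ → List Bool → Bool
playableAt i = playableFrom i 0

-- Vertices beyond the ends of the path behave like dominated ones, so in the padded list every
-- move dominates a window of three consecutive entries.
pad : List Bool → List Bool
pad xs = true ∷ (xs ∷ʳ true)

near-suc : ∀ i j → near (suc i) (suc j) ≡ near i j
near-suc i j = cong₂ _∧_ (<ᵇ-suc i (suc j)) (<ᵇ-suc j (suc i))
  where
  <ᵇ-suc : ∀ m n → (m <ᵇ suc n) ≡ (m ≤ᵇ n)
  <ᵇ-suc zero    n = refl
  <ᵇ-suc (suc m) n = refl

dominateFrom-suc : ∀ i p xs → dominateFrom (suc i) (suc p) xs ≡ dominateFrom i p xs
dominateFrom-suc i p []       = refl
dominateFrom-suc i p (x ∷ xs) = cong₂ _∷_ (cong (x ∨_) (near-suc i p)) (dominateFrom-suc i (suc p) xs)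

dominateFrom-far : ∀ p xs → dominateFrom 0 (suc (suc p)) xs ≡ xs
dominateFrom-far p []       = refl
dominateFrom-far p (x ∷ xs) = cong₂ _∷_ (∨-identityʳ x) (dominateFrom-far (suc p) xs)

dominate-window : ∀ pre x y z post →
  dominateFrom (suc (length pre)) 0 (pre ++ x ∷ y ∷ z ∷ post) ≡ pre ++ true ∷ true ∷ true ∷ post
dominate-window [] x y z post =
  cong₂ _∷_ (∨-zeroʳ x) (cong₂ _∷_ (∨-zeroʳ y) (cong₂ _∷_ (∨-zeroʳ z)
    (trans (dominateFrom-suc 0 2 post) (dominateFrom-far 0 post))))
dominate-window (a ∷ pre) x y z post =
  cong₂ _∷_ (∨-identityʳ a) (trans (dominateFrom-suc (suc (length pre)) 0 _) (dominate-window pre x y z post))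

dominateFrom-∷ʳ-true : ∀ i p xs → dominateFrom i p (xs ∷ʳ true) ≡ dominateFrom i p xs ∷ʳ true
dominateFrom-∷ʳ-true i p []       = refl
dominateFrom-∷ʳ-true i p (x ∷ xs) = cong (_ ∷_) (dominateFrom-∷ʳ-true i (suc p) xs)

pad-dominate : ∀ j xs → pad (dominate j xs) ≡ dominateFrom (suc j) 0 (pad xs)
pad-dominate j xs = cong (true ∷_) (sym (begin
  dominateFrom (suc j) 1 (xs ∷ʳ true)  ≡⟨ dominateFrom-suc j 0 _ ⟩
  dominate j (xs ∷ʳ true)              ≡⟨ dominateFrom-∷ʳ-true j 0 xs ⟩
  dominate j xs ∷ʳ true                ∎))

length-pad : ∀ xs → length (pad xs) ≡ 2 + length xs
length-pad xs = cong suc (trans (length-++ xs) (+-comm (length xs) 1))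

pad-injective : ∀ {xs ys} → pad xs ≡ pad ys → xs ≡ ys
pad-injective {xs} {ys} eq = proj₁ (∷ʳ-injective xs ys (proj₂ (∷-injective eq)))

value-pad : ∀ xs → value (pad xs) ≡ value xs
value-pad = value-∷ʳ-true

split-window : ∀ j (zs : List Bool) → 3 + j ≤ length zs →
  ∃[ pre ] ∃[ x ] ∃[ y ] ∃[ z ] ∃[ post ] zs ≡ pre ++ x ∷ y ∷ z ∷ post × length pre ≡ j
split-window zero    (x ∷ y ∷ z ∷ post) _            = [] , x , y , z , post , refl , refl
split-window zero    (_ ∷ [])           (s≤s ())
split-window zero    (_ ∷ _ ∷ [])       (s≤s (s≤s ()))
split-window (suc j) (a ∷ zs)           (s≤s 3+j≤n) with split-window j zs 3+j≤n
... | pre , x , y , z , post , refl , refl = a ∷ pre , x , y , z , post , refl , refl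

pad-window : ∀ j xs → j < length xs →
  ∃[ pre ] ∃[ x ] ∃[ y ] ∃[ z ] ∃[ post ] pad xs ≡ pre ++ x ∷ y ∷ z ∷ post × length pre ≡ j
pad-window j xs j<n = split-window j (pad xs) (subst (3 + j ≤_) (sym (length-pad xs)) (s≤s (s≤s j<n)))

window-length : ∀ pre {x y z : Bool} post → 2 + length pre < length (pre ++ x ∷ y ∷ z ∷ post)
window-length []        post = s≤s (s≤s (s≤s z≤n))
window-length (_ ∷ pre) post = s≤s (window-length pre post)

window-index< : ∀ xs pre {x y z} post → pad xs ≡ pre ++ x ∷ y ∷ z ∷ post → length pre < length xs
window-index< xs pre post eq =
  s<s⁻¹ (s<s⁻¹ (subst (2 + length pre <_) (trans (cong length (sym eq)) (length-pad xs)) (window-length pre post)))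

move-window : ∀ xs pre {x y z} post → pad xs ≡ pre ++ x ∷ y ∷ z ∷ post →
  pad (dominate (length pre) xs) ≡ pre ++ true ∷ true ∷ true ∷ post
move-window xs pre {x} {y} {z} post eq = begin
  pad (dominate (length pre) xs)                                 ≡⟨ pad-dominate (length pre) xs ⟩
  dominateFrom (suc (length pre)) 0 (pad xs)                     ≡⟨ cong (dominateFrom (suc (length pre)) 0) eq ⟩
  dominateFrom (suc (length pre)) 0 (pre ++ x ∷ y ∷ z ∷ post)    ≡⟨ dominate-window pre x y z post ⟩
  pre ++ true ∷ true ∷ true ∷ post                               ∎

value-move-window : ∀ xs pre {x y z} post → pad xs ≡ pre ++ x ∷ y ∷ z ∷ post →
  value (dominate (length pre) xs) ≡ value (pre ++ true ∷ true ∷ true ∷ post)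
value-move-window xs pre post eq = begin
  value (dominate (length pre) xs)          ≡⟨ value-pad (dominate (length pre) xs) ⟨
  value (pad (dominate (length pre) xs))    ≡⟨ cong value (move-window xs pre post eq) ⟩
  value (pre ++ true ∷ true ∷ true ∷ post)  ∎

undominated : List Bool → ℕ
undominated []           = 0
undominated (true ∷ xs)  = undominated xs
undominated (false ∷ xs) = suc (undominated xs)

unplayable⇒unchanged : ∀ i p xs → playableFrom i p xs ≡ false → dominateFrom i p xs ≡ xs
unplayable⇒unchanged i p []       _ = refl
unplayable⇒unchanged i p (x ∷ xs) h with near i p | x
... | false | x     = cong₂ _∷_ (∨-identityʳ x) (unplayable⇒unchanged i (suc p) xs h)
... | true  | true  = cong (true ∷_) (unplayable⇒unchanged i (suc p) xs h)

dominate-undominated-≤ : ∀ i p xs → undominated (dominateFrom i p xs) ≤ undominated xs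
dominate-undominated-≤ i p []       = z≤n
dominate-undominated-≤ i p (x ∷ xs) with near i p | x
... | _     | true  = dominate-undominated-≤ i (suc p) xs
... | false | false = s≤s (dominate-undominated-≤ i (suc p) xs)
... | true  | false = m≤n⇒m≤1+n (dominate-undominated-≤ i (suc p) xs)

playable⇒undominated-< : ∀ i p xs → playableFrom i p xs ≡ true →
                         undominated (dominateFrom i p xs) < undominated xs
playable⇒undominated-< i p (x ∷ xs) h with near i p | x
... | false | true  = playable⇒undominated-< i (suc p) xs h
... | true  | true  = playable⇒undominated-< i (suc p) xs h
... | false | false = s≤s (playable⇒undominated-< i (suc p) xs h)
... | true  | false = s≤s (dominate-undominated-≤ i (suc p) xs)

value-changed⇒playable : ∀ i xs → value (dominate i xs) ≢ value xs → playableAt i xs ≡ true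
value-changed⇒playable i xs changed with playableAt i xs in eq
... | true  = refl
... | false = ⊥-elim (changed (cong value (unplayable⇒unchanged i 0 xs eq)))

true∈dominate : ∀ j xs → j < length xs → true ∈ dominate j xs
true∈dominate zero    (x ∷ xs) _         = here (sym (∨-zeroʳ x))
true∈dominate (suc j) (x ∷ xs) (s≤s j<n) =
  there (subst (true ∈_) (sym (dominateFrom-suc j 0 xs)) (true∈dominate j xs j<n))

-- No dominated vertex between two undominated ones

NoIsolated : List Bool → Set
NoIsolated (x ∷ y ∷ z ∷ xs) = (x , y , z) ≢ (false , true , false) × NoIsolated (y ∷ z ∷ xs)
NoIsolated _                = ⊤

NoIsolated-∷⁻ : ∀ x xs → NoIsolated (x ∷ xs) → NoIsolated xs
NoIsolated-∷⁻ x []           _       = tt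
NoIsolated-∷⁻ x (y ∷ [])     _       = tt
NoIsolated-∷⁻ x (y ∷ z ∷ xs) (_ , h) = h

NoIsolated-++⁻ʳ : ∀ xs {ys} → NoIsolated (xs ++ ys) → NoIsolated ys
NoIsolated-++⁻ʳ []       h = h
NoIsolated-++⁻ʳ (x ∷ xs) h = NoIsolated-++⁻ʳ xs (NoIsolated-∷⁻ x _ h)

NoIsolated-++⁻ˡ : ∀ xs {ys} → NoIsolated (xs ++ ys) → NoIsolated xs
NoIsolated-++⁻ˡ []               _       = tt
NoIsolated-++⁻ˡ (x ∷ [])         _       = tt
NoIsolated-++⁻ˡ (x ∷ y ∷ [])     _       = tt
NoIsolated-++⁻ˡ (x ∷ y ∷ z ∷ xs) (t , h) = t , NoIsolated-++⁻ˡ (y ∷ z ∷ xs) h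

NoIsolated-true∷ : ∀ xs → NoIsolated xs → NoIsolated (true ∷ xs)
NoIsolated-true∷ []           _ = tt
NoIsolated-true∷ (y ∷ [])     _ = tt
NoIsolated-true∷ (y ∷ z ∷ xs) h = (λ ()) , h

NoIsolated-++-true∷true∷ : ∀ pre {ys} → NoIsolated pre → NoIsolated (true ∷ true ∷ ys) →
                           NoIsolated (pre ++ true ∷ true ∷ ys)
NoIsolated-++-true∷true∷ []               _       k = k
NoIsolated-++-true∷true∷ (x ∷ [])         _       k = (λ ()) , k
NoIsolated-++-true∷true∷ (x ∷ y ∷ [])     _       k = (λ ()) , NoIsolated-++-true∷true∷ (y ∷ []) tt k
NoIsolated-++-true∷true∷ (x ∷ y ∷ z ∷ xs) (t , h) k = t , NoIsolated-++-true∷true∷ (y ∷ z ∷ xs) h k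

NoIsolated-window : ∀ pre {x y z} post → NoIsolated (pre ++ x ∷ y ∷ z ∷ post) →
                    NoIsolated (pre ++ true ∷ true ∷ true ∷ post)
NoIsolated-window pre post h =
  NoIsolated-++-true∷true∷ pre (NoIsolated-++⁻ˡ pre h)
    (NoIsolated-true∷ _ (NoIsolated-true∷ _ (NoIsolated-true∷ post
      (NoIsolated-∷⁻ _ _ (NoIsolated-∷⁻ _ _ (NoIsolated-∷⁻ _ _ (NoIsolated-++⁻ʳ pre h)))))))

NoIsolated-dominate : ∀ j xs → NoIsolated (pad xs) → j < length xs → NoIsolated (pad (dominate j xs))
NoIsolated-dominate j xs inv j<n with pad-window j xs j<n
... | pre , _ , _ , _ , post , eq , refl =
  subst NoIsolated (sym (move-window xs pre post eq)) (NoIsolated-window pre post (subst NoIsolated eq inv))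

isolated-window : ∀ pre post → ¬ NoIsolated (pre ++ false ∷ true ∷ false ∷ post)
isolated-window pre post h = proj₁ (NoIsolated-++⁻ʳ pre h) refl

NoIsolated-left : ∀ pre {t} post → NoIsolated (pre ++ t ∷ true ∷ false ∷ post) → t ≡ true
NoIsolated-left pre {true}  post h = refl
NoIsolated-left pre {false} post h = ⊥-elim (isolated-window pre post h)

NoIsolated-right : ∀ pre {t} post → NoIsolated (pre ++ false ∷ true ∷ t ∷ post) → t ≡ true
NoIsolated-right pre {true}  post h = refl
NoIsolated-right pre {false} post h = ⊥-elim (isolated-window pre post h)

NoIsolated-start : ∀ n → NoIsolated (pad (replicate n false))
NoIsolated-start n = NoIsolated-true∷ _ (falses-then-true n)
  where
  falses-then-true : ∀ n → NoIsolated (replicate n false ∷ʳ true)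
  falses-then-true zero                = tt
  falses-then-true (suc zero)          = tt
  falses-then-true (suc (suc zero))    = (λ ()) , tt
  falses-then-true (suc (suc (suc n))) = (λ ()) , falses-then-true (suc (suc n))

-- No move keeps the value

window-value-mod-4 : ∀ w w′ →
  (∀ (a b : Fin 4) → flankedValue (toℕ a) w (toℕ b) ≢ flankedValue (toℕ a) w′ (toℕ b)) →
  ∀ l r → flankedValue l w r ≢ flankedValue l w′ r
window-value-mod-4 w w′ differ l r same =
  differ (residue l) (residue r) (trans (sym (reduce w)) (trans same (reduce w′)))
  where
  reduce : ∀ ws → flankedValue l ws r ≡ flankedValue (toℕ (residue l)) ws (toℕ (residue r))
  reduce ws = trans (runValue-replicateʳ l ws (sym (residue-toℕ (residue r))))
                    (runValue-residue (ws ++ _) (sym (residue-toℕ (residue l))))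

changes-value? : ∀ x y z → Dec (∀ (a b : Fin 4) →
  flankedValue (toℕ a) (x ∷ y ∷ z ∷ []) (toℕ b) ≢ flankedValue (toℕ a) (true ∷ true ∷ true ∷ []) (toℕ b))
changes-value? x y z = all? λ a → all? λ b → ¬? (
  flankedValue (toℕ a) (x ∷ y ∷ z ∷ []) (toℕ b) ≟ flankedValue (toℕ a) (true ∷ true ∷ true ∷ []) (toℕ b))

window-changes-value : ∀ x y z → {True (changes-value? x y z)} → ∀ l r →
  flankedValue l (x ∷ y ∷ z ∷ []) r ≢ flankedValue l (true ∷ true ∷ true ∷ []) r
window-changes-value x y z {check} =
  window-value-mod-4 (x ∷ y ∷ z ∷ []) (true ∷ true ∷ true ∷ []) (toWitness check)

window-value-fixed : ∀ x y z l r →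
  flankedValue l (x ∷ y ∷ z ∷ []) r ≡ flankedValue l (true ∷ true ∷ true ∷ []) r →
  (x , y , z) ≡ (true , true , true) ⊎ (x , y , z) ≡ (false , true , false)
window-value-fixed true  true  true  _ _ _    = inj₁ refl
window-value-fixed false true  false _ _ _    = inj₂ refl
window-value-fixed true  true  false l r same = ⊥-elim (window-changes-value true  true  false l r same)
window-value-fixed true  false true  l r same = ⊥-elim (window-changes-value true  false true  l r same)
window-value-fixed true  false false l r same = ⊥-elim (window-changes-value true  false false l r same)
window-value-fixed false true  true  l r same = ⊥-elim (window-changes-value false true  true  l r same)
window-value-fixed false false true  l r same = ⊥-elim (window-changes-value false false true  l r same)
window-value-fixed false false false l r same = ⊥-elim (window-changes-value false false false l r same)

option-value-≢ : ∀ j xs → NoIsolated (pad xs) → j < length xs → playableAt j xs ≡ true →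
                 value (dominate j xs) ≢ value xs
option-value-≢ j xs inv j<n playable same with pad-window j xs j<n
... | pre , x , y , z , post , eq , refl with window-value pre post
... | a , l , r , b , value-window with window-value-fixed x y z l r (⊕-cancelʳ b _ _ (⊕-cancelˡ a _ _ values))
  where
  values : a ⊕ (flankedValue l (x ∷ y ∷ z ∷ []) r ⊕ b) ≡
           a ⊕ (flankedValue l (true ∷ true ∷ true ∷ []) r ⊕ b)
  values = begin
    a ⊕ (flankedValue l (x ∷ y ∷ z ∷ []) r ⊕ b)           ≡⟨ value-window (x ∷ y ∷ z ∷ []) ⟨
    value (pre ++ x ∷ y ∷ z ∷ post)                        ≡⟨ cong value eq ⟨
    value (pad xs)                                         ≡⟨ value-pad xs ⟩
    value xs                                               ≡⟨ same ⟨
    value (dominate j xs)                                  ≡⟨ value-move-window xs pre post eq ⟩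
    value (pre ++ true ∷ true ∷ true ∷ post)               ≡⟨ value-window (true ∷ true ∷ true ∷ []) ⟩
    a ⊕ (flankedValue l (true ∷ true ∷ true ∷ []) r ⊕ b)  ∎
... | inj₁ refl = <-irrefl refl (subst (λ ys → undominated ys < undominated xs) unchanged
                                       (playable⇒undominated-< j 0 xs playable))
  where
  unchanged : dominate j xs ≡ xs
  unchanged = pad-injective (trans (move-window xs pre post eq) (sym eq))
... | inj₂ refl = isolated-window pre post (subst NoIsolated eq inv)

-- Every smaller value is reached by a move

IsXorHom : (Fin 4 → Bool) → Set
IsXorHom χ = ∀ a b → χ (a ⊕ b) ≡ χ a xor χ b

lowBit highBit : Fin 4 → Bool
lowBit 1F  = true
lowBit 3F  = true
lowBit _   = false
highBit 2F = true
highBit 3F = true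
highBit _  = false

lowBit-hom : IsXorHom lowBit
lowBit-hom = from-yes (all? λ a → all? λ b → lowBit (a ⊕ b) Bool.≟ lowBit a xor lowBit b)

highBit-hom : IsXorHom highBit
highBit-hom = from-yes (all? λ a → all? λ b → highBit (a ⊕ b) Bool.≟ highBit a xor highBit b)

topBitOf : Fin 4 → Fin 4 → Bool
topBitOf δ = if highBit δ then highBit else lowBit

topBitOf-hom : ∀ δ → IsXorHom (topBitOf δ)
topBitOf-hom δ with highBit δ
... | true  = highBit-hom
... | false = lowBit-hom

topBitOf-larger : ∀ g t → t <ᶠ g → topBitOf (g ⊕ t) g ≡ true
topBitOf-larger = from-yes (all? λ g → all? λ t → t <? g →-dec topBitOf (g ⊕ t) g Bool.≟ true)

topBitOf-descent : ∀ δ r → δ ≢ 0F → topBitOf δ r ≡ true → r ⊕ δ <ᶠ r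
topBitOf-descent = from-yes (all? λ δ → all? λ r →
  ¬? (δ ≟ 0F) →-dec topBitOf δ r Bool.≟ true →-dec r ⊕ δ <? r)

<⇒⊕≢0 : ∀ g t → t <ᶠ g → g ⊕ t ≢ 0F
<⇒⊕≢0 = from-yes (all? λ g → all? λ t → t <? g →-dec ¬? (g ⊕ t ≟ 0F))

⊕-retarget : ∀ a r b g t → a ⊕ (r ⊕ b) ≡ g → a ⊕ (r ⊕ (g ⊕ t) ⊕ b) ≡ t
⊕-retarget = from-yes (all? λ a → all? λ r → all? λ b → all? λ g → all? λ t →
  (a ⊕ (r ⊕ b) ≟ g) →-dec (a ⊕ (r ⊕ (g ⊕ t) ⊕ b) ≟ t))

replicate-false-∷ : ∀ c zs → replicate c false ++ false ∷ zs ≡ false ∷ replicate c false ++ zs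
replicate-false-∷ zero    zs = refl
replicate-false-∷ (suc c) zs = cong (false ∷_) (replicate-false-∷ c zs)

module _ (χ : Fin 4 → Bool) (χ-hom : IsXorHom χ) where

  find-run-from : ∀ p c ys → χ (runValue c ys) ≡ true →
    ∃[ p′ ] ∃[ L ] ∃[ q ]
      p ++ true ∷ replicate c false ++ (ys ∷ʳ true) ≡ p′ ++ true ∷ replicate L false ++ true ∷ q
      × χ (residue L) ≡ true
  find-run-from p c []           χc = p , c , [] , refl , χc
  find-run-from p c (false ∷ ys) χc with find-run-from p (suc c) ys χc
  ... | p′ , L , q , eq , χL = p′ , L , q , trans (cong (λ zs → p ++ true ∷ zs) (replicate-false-∷ c _)) eq , χL
  find-run-from p c (true ∷ ys)  χc with χ (residue c) in χr
  ... | true  = p , c , ys ∷ʳ true , refl , χr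
  ... | false with find-run-from (p ++ true ∷ replicate c false) 0 ys (trans (sym χ-split) χc)
    where
    χ-split : χ (residue c ⊕ value ys) ≡ χ (value ys)
    χ-split = trans (χ-hom (residue c) (value ys)) (cong (_xor χ (value ys)) χr)
  ... | p′ , L , q , eq , χL = p′ , L , q , trans (sym (++-assoc p _ _)) eq , χL

  find-run : ∀ xs → χ (value xs) ≡ true →
    ∃[ p ] ∃[ L ] ∃[ q ] pad xs ≡ p ++ true ∷ replicate L false ++ true ∷ q × χ (residue L) ≡ true
  find-run = find-run-from [] 0

data Trim : ℕ → ℕ → Set where
  trim1 : ∀ m → Trim (1 + m) m
  trim2 : ∀ m → Trim (2 + m) m
  trim3 : ∀ m → Trim (3 + m) m

trim-residue : ∀ L t → t <ᶠ residue L → ∃[ m ] Trim L m × residue m ≡ t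
trim-residue 0 t ()
trim-residue 1 0F _ = 0 , trim1 0 , refl
trim-residue 2 0F _ = 0 , trim2 0 , refl
trim-residue 2 1F _ = 1 , trim1 1 , refl
trim-residue 3 0F _ = 0 , trim3 0 , refl
trim-residue 3 1F _ = 1 , trim2 1 , refl
trim-residue 3 2F _ = 2 , trim1 2 , refl
trim-residue 1 (Fin.suc _)                     (s≤s ())
trim-residue 2 (Fin.suc (Fin.suc _))           (s≤s (s≤s ()))
trim-residue 3 (Fin.suc (Fin.suc (Fin.suc _))) (s≤s (s≤s (s≤s ())))
trim-residue (suc (suc (suc (suc L)))) t t<r with trim-residue L t t<r
... | m , trim1 _ , eq = 4 + m , trim1 (4 + m) , eq
... | m , trim2 _ , eq = 4 + m , trim2 (4 + m) , eq
... | m , trim3 _ , eq = 4 + m , trim3 (4 + m) , eq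

HasOption : List Bool → Fin 4 → Set
HasOption xs t = ∃[ j ] j < length xs × value (dominate j xs) ≡ t

window-option : ∀ xs pre {x y z} post → pad xs ≡ pre ++ x ∷ y ∷ z ∷ post →
                HasOption xs (value (pre ++ true ∷ true ∷ true ∷ post))
window-option xs pre post eq = length pre , window-index< xs pre post eq , value-move-window xs pre post eq

true∉falses : ∀ n → true ∉ replicate n false
true∉falses (suc n) (there t∈) = true∉falses n t∈

-- The dominated neighbour of the run is played: by NoIsolated its other neighbour is dominated
-- as well, and one of the two neighbours lies inside the path as some vertex is dominated.
trim1-option : ∀ xs p q m → pad xs ≡ p ++ true ∷ replicate (1 + m) false ++ true ∷ q →
  NoIsolated (pad xs) → true ∈ xs → HasOption xs (value p ⊕ (residue m ⊕ value q))
trim1-option xs p q m eq inv t∈xs with reverseView p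
... | p′ ∶ _ ∶ʳ t = subst (HasOption xs) value-moved (window-option xs p′ rest eq′)
  where
  rest : List Bool
  rest = replicate m false ++ true ∷ q
  eq′ : pad xs ≡ p′ ++ t ∷ true ∷ false ∷ rest
  eq′ = trans eq (++-assoc p′ _ _)
  value-moved : value (p′ ++ true ∷ true ∷ true ∷ rest) ≡ value (p′ ∷ʳ t) ⊕ (residue m ⊕ value q)
  value-moved = begin
    value (p′ ++ true ∷ true ∷ true ∷ rest)     ≡⟨ value-trimmed p′ m q ⟩
    value p′ ⊕ (residue m ⊕ value q)            ≡⟨ cong (_⊕ (residue m ⊕ value q)) (value-∷ʳ-true p′) ⟨
    value (p′ ∷ʳ true) ⊕ (residue m ⊕ value q)  ≡⟨ cong (λ s → value (p′ ∷ʳ s) ⊕ (residue m ⊕ value q))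
                                                      (NoIsolated-left p′ rest (subst NoIsolated eq′ inv)) ⟨
    value (p′ ∷ʳ t) ⊕ (residue m ⊕ value q)     ∎
... | [] with q
...   | [] = ⊥-elim (true∉falses (suc m) (subst (true ∈_) (pad-injective eq) t∈xs))
...   | t ∷ q′ = subst (HasOption xs) value-moved (window-option xs (true ∷ replicate m false) q′ eq′)
  where
  eq′ : pad xs ≡ (true ∷ replicate m false) ++ false ∷ true ∷ t ∷ q′
  eq′ = trans eq (cong (true ∷_) (sym (replicate-false-∷ m _)))
  value-moved : value (true ∷ replicate m false ++ true ∷ true ∷ true ∷ q′) ≡ residue m ⊕ value (t ∷ q′)
  value-moved = trans (value-replicate-++-∷ m (true ∷ true ∷ q′))
                      (cong (λ s → residue m ⊕ value (s ∷ q′))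
                            (sym (NoIsolated-right (true ∷ replicate m false) q′ (subst NoIsolated eq′ inv))))

trim-option : ∀ xs p {L} q {m} → pad xs ≡ p ++ true ∷ replicate L false ++ true ∷ q →
  NoIsolated (pad xs) → true ∈ xs → Trim L m → HasOption xs (value p ⊕ (residue m ⊕ value q))
trim-option xs p q eq inv t∈xs (trim1 m) = trim1-option xs p q m eq inv t∈xs
trim-option xs p q eq inv t∈xs (trim2 m) =
  subst (HasOption xs) (value-trimmed p m q) (window-option xs p (replicate m false ++ true ∷ q) eq)
trim-option xs p q eq inv t∈xs (trim3 m) =
  subst (HasOption xs) value-moved (window-option xs (p ∷ʳ true) rest (trans eq (sym (++-assoc p _ _))))
  where
  rest : List Bool
  rest = replicate m false ++ true ∷ q
  value-moved : value ((p ∷ʳ true) ++ true ∷ true ∷ true ∷ rest) ≡ value p ⊕ (residue m ⊕ value q)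
  value-moved = trans (value-trimmed (p ∷ʳ true) m q) (cong (_⊕ (residue m ⊕ value q)) (value-∷ʳ-true p))

smaller-value-option : ∀ xs t → NoIsolated (pad xs) → true ∈ xs → t <ᶠ value xs → HasOption xs t
smaller-value-option xs t inv t∈xs t<g
  with find-run (topBitOf (value xs ⊕ t)) (topBitOf-hom (value xs ⊕ t)) xs (topBitOf-larger (value xs) t t<g)
... | p , L , q , eq , χL
  with trim-residue L (residue L ⊕ (value xs ⊕ t)) (topBitOf-descent _ (residue L) (<⇒⊕≢0 (value xs) t t<g) χL)
... | m , trim , residue-m = subst (HasOption xs) retargeted (trim-option xs p q eq inv t∈xs trim)
  where
  value-split : value p ⊕ (residue L ⊕ value q) ≡ value xs
  value-split = trans (sym (value-run p L q)) (trans (cong value (sym eq)) (value-pad xs))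
  retargeted : value p ⊕ (residue m ⊕ value q) ≡ t
  retargeted = trans (cong (λ r → value p ⊕ (r ⊕ value q)) residue-m)
                     (⊕-retarget (value p) (residue L) (value q) (value xs) t value-split)

-- Nimbers of positions with a dominated vertex

memberℕ-∈ : ∀ {k} xs → memberℕ k xs ≡ true → k ∈ xs
memberℕ-∈ {k} xs eq = Any.map (≡ᵇ⇒≡ k _) (any⁻ _ xs (Equivalence.from T-≡ eq))

∈-memberℕ : ∀ {k} xs → k ∈ xs → memberℕ k xs ≡ true
∈-memberℕ {k} xs k∈xs = Equivalence.to T-≡ (any⁺ _ (Any.map (≡⇒≡ᵇ k _) k∈xs))

firstNotIn-applyUpTo : ∀ xs f n g → g < n → (∀ i → i < g → f i ∈ xs) → f g ∉ xs →
                       firstNotIn xs (applyUpTo f n) ≡ f g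
firstNotIn-applyUpTo xs f (suc n) zero _ _ fg∉xs with memberℕ (f 0) xs in eq
... | true  = ⊥-elim (fg∉xs (memberℕ-∈ xs eq))
... | false = refl
firstNotIn-applyUpTo xs f (suc n) (suc g) (s≤s g<n) earlier∈ fg∉xs with memberℕ (f 0) xs in eq
... | true  = firstNotIn-applyUpTo xs (f ∘ suc) n g g<n (λ i i<g → earlier∈ (suc i) (s≤s i<g)) fg∉xs
... | false with () ← trans (sym eq) (∈-memberℕ xs (earlier∈ 0 z<s))

covered-≤-length : ∀ g xs → (∀ j → j < g → j ∈ xs) → g ≤ length xs
covered-≤-length g xs covered = ≮⇒≥ λ length<g →
  let i , j , i<j , same-position = pigeonhole length<g position
  in <⇒≢ i<j (trans (lookup-index (cover i)) (trans (cong (lookup xs) same-position) (sym (lookup-index (cover j)))))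
  where
  cover : ∀ (i : Fin g) → toℕ i ∈ xs
  cover i = covered (toℕ i) (toℕ<n i)
  position : Fin g → Fin (length xs)
  position i = Any.index (cover i)

mex-≡ : ∀ xs g → (∀ j → j < g → j ∈ xs) → g ∉ xs → mex xs ≡ g
mex-≡ xs g covered g∉xs =
  firstNotIn-applyUpTo xs id (suc (length xs)) g (s≤s (covered-≤-length g xs covered)) covered g∉xs

nimberFuel-suc-mex : ∀ k {n} (D : Position n) g →
  (∀ v → playable D v ≡ true → nimberFuel k (play D v) ≢ g) →
  (∀ j → j < g → ∃[ v ] playable D v ≡ true × nimberFuel k (play D v) ≡ j) →
  nimberFuel (suc k) D ≡ g
nimberFuel-suc-mex k {n} D g fresh reached = mex-≡ options g covered g∉options
  where
  option : Fin n → ℕ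
  option v = nimberFuel k (play D v)
  options : List ℕ
  options = map option (filter (T? ∘ playable D) (allFin n))
  covered : ∀ j → j < g → j ∈ options
  covered j j<g with reached j j<g
  ... | v , pv , refl = ∈-map⁺ option (∈-filter⁺ (T? ∘ playable D) (∈-allFin v) (Equivalence.from T-≡ pv))
  g∉options : g ∉ options
  g∉options g∈ with ∈-map⁻ option g∈
  ... | v , v∈ , refl =
    fresh v (Equivalence.to T-≡ (proj₂ (∈-filter⁻ (T? ∘ playable D) {xs = allFin n} v∈))) refl

tabulate-dominateFrom : ∀ {n} (f : Fin n → Bool) i p →
  tabulate (λ w → f w ∨ near i (toℕ w + p)) ≡ dominateFrom i p (tabulate f)
tabulate-dominateFrom {zero}  f i p = refl
tabulate-dominateFrom {suc n} f i p = cong ((f Fin.zero ∨ near i p) ∷_) (begin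
  tabulate (λ w → f (Fin.suc w) ∨ near i (suc (toℕ w + p)))
    ≡⟨ tabulate-cong (λ w → cong (λ k → f (Fin.suc w) ∨ near i k) (sym (+-suc (toℕ w) p))) ⟩
  tabulate (λ w → f (Fin.suc w) ∨ near i (toℕ w + suc p))
    ≡⟨ tabulate-dominateFrom (f ∘ Fin.suc) i (suc p) ⟩
  dominateFrom i (suc p) (tabulate (f ∘ Fin.suc))
    ∎)

tabulate-playableFrom : ∀ {n} (f : Fin n → Bool) i p →
  or (tabulate (λ w → near i (toℕ w + p) ∧ not (f w))) ≡ playableFrom i p (tabulate f)
tabulate-playableFrom {zero}  f i p = refl
tabulate-playableFrom {suc n} f i p = cong ((near i p ∧ not (f Fin.zero)) ∨_) (begin
  or (tabulate (λ w → near i (suc (toℕ w + p)) ∧ not (f (Fin.suc w))))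
    ≡⟨ cong or (tabulate-cong (λ w → cong (λ k → near i k ∧ not (f (Fin.suc w))) (sym (+-suc (toℕ w) p)))) ⟩
  or (tabulate (λ w → near i (toℕ w + suc p) ∧ not (f (Fin.suc w))))
    ≡⟨ tabulate-playableFrom (f ∘ Fin.suc) i (suc p) ⟩
  playableFrom i (suc p) (tabulate (f ∘ Fin.suc))
    ∎)

tabulate-play : ∀ {n} (D : Position n) v → tabulate (play D v) ≡ dominate (toℕ v) (tabulate D)
tabulate-play D v = trans (tabulate-cong (λ w → cong (λ k → D w ∨ near (toℕ v) k) (sym (+-identityʳ (toℕ w)))))
                          (tabulate-dominateFrom D (toℕ v) 0)

playable-tabulate : ∀ {n} (D : Position n) v → playable D v ≡ playableAt (toℕ v) (tabulate D)
playable-tabulate {n} D v = begin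
  or (map (λ w → dominatesP v w ∧ not (D w)) (allFin n))
    ≡⟨ cong or (map-tabulate id (λ w → dominatesP v w ∧ not (D w))) ⟩
  or (tabulate (λ w → near (toℕ v) (toℕ w) ∧ not (D w)))
    ≡⟨ cong or (tabulate-cong (λ w → cong (λ k → near (toℕ v) k ∧ not (D w)) (sym (+-identityʳ (toℕ w))))) ⟩
  or (tabulate (λ w → near (toℕ v) (toℕ w + 0) ∧ not (D w)))
    ≡⟨ tabulate-playableFrom D (toℕ v) 0 ⟩
  playableAt (toℕ v) (tabulate D)
    ∎

toℕ<length-tabulate : ∀ {n} (D : Position n) v → toℕ v < length (tabulate D)
toℕ<length-tabulate D v = subst (toℕ v <_) (sym (length-tabulate D)) (toℕ<n v)

value-all-dominated : ∀ xs → undominated xs ≤ 0 → value xs ≡ 0F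
value-all-dominated []          _ = refl
value-all-dominated (true ∷ xs) h = value-all-dominated xs h

list-option⇒vertex : ∀ {n} (D : Position n) t → HasOption (tabulate D) t → t ≢ value (tabulate D) →
  ∃[ v ] playable D v ≡ true × value (dominate (toℕ v) (tabulate D)) ≡ t
list-option⇒vertex {n} D t (i , i<n , value-i) t≢g =
  v , playable-v , trans (cong (λ j → value (dominate j xs)) toℕ-v) value-i
  where
  xs : List Bool
  xs = tabulate D
  v : Fin n
  v = fromℕ< (subst (i <_) (length-tabulate D) i<n)
  toℕ-v : toℕ v ≡ i
  toℕ-v = toℕ-fromℕ< _
  playable-v : playable D v ≡ true
  playable-v = trans (playable-tabulate D v) (subst (λ j → playableAt j xs ≡ true) (sym toℕ-v)
                 (value-changed⇒playable i xs (λ same → t≢g (trans (sym value-i) same))))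

below-toℕ : ∀ {n} (g : Fin n) j → j < toℕ g → ∃[ t ] toℕ t ≡ j × t <ᶠ g
below-toℕ g j j<g = fromℕ< (<-trans j<g (toℕ<n g)) , toℕ-fromℕ< _ , subst (_< toℕ g) (sym (toℕ-fromℕ< _)) j<g

mutual
  nimberFuel-value : ∀ k {n} (D : Position n) → NoIsolated (pad (tabulate D)) → true ∈ tabulate D →
                     undominated (tabulate D) ≤ k → nimberFuel k D ≡ toℕ (value (tabulate D))
  nimberFuel-value zero    D _   _    und≤0 = cong toℕ (sym (value-all-dominated (tabulate D) und≤0))
  nimberFuel-value (suc k) D inv t∈xs und≤ = nimberFuel-suc-mex k D (toℕ (value xs)) fresh reached
    where
    xs : List Bool
    xs = tabulate D
    fresh : ∀ v → playable D v ≡ true → nimberFuel k (play D v) ≢ toℕ (value xs)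
    fresh v pv same = option-value-≢ (toℕ v) xs inv (toℕ<length-tabulate D v) (trans (sym (playable-tabulate D v)) pv)
                        (toℕ-injective (trans (sym (option-nimber k D v inv und≤ pv)) same))
    reached : ∀ j → j < toℕ (value xs) → ∃[ v ] playable D v ≡ true × nimberFuel k (play D v) ≡ j
    reached j j<g =
      let t , toℕ-t , t<g = below-toℕ (value xs) j j<g
          v , pv , value-v = list-option⇒vertex D t (smaller-value-option xs t inv t∈xs t<g) (<⇒≢ t<g ∘ cong toℕ)
      in v , pv , trans (option-nimber k D v inv und≤ pv) (trans (cong toℕ value-v) toℕ-t)

  option-nimber : ∀ k {n} (D : Position n) v → NoIsolated (pad (tabulate D)) → undominated (tabulate D) ≤ suc k →
                  playable D v ≡ true → nimberFuel k (play D v) ≡ toℕ (value (dominate (toℕ v) (tabulate D)))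
  option-nimber k D v inv und≤ pv = begin
    nimberFuel k (play D v)
      ≡⟨ nimberFuel-value k (play D v) (moved (NoIsolated ∘ pad) inv′) (moved (true ∈_) t∈′)
                                       (moved ((_≤ k) ∘ undominated) und′) ⟩
    toℕ (value (tabulate (play D v)))
      ≡⟨ cong (toℕ ∘ value) (tabulate-play D v) ⟩
    toℕ (value (dominate (toℕ v) (tabulate D)))
      ∎
    where
    xs : List Bool
    xs = tabulate D
    moved : ∀ (P : List Bool → Set) → P (dominate (toℕ v) xs) → P (tabulate (play D v))
    moved P = subst P (sym (tabulate-play D v))
    inv′ : NoIsolated (pad (dominate (toℕ v) xs))
    inv′ = NoIsolated-dominate (toℕ v) xs inv (toℕ<length-tabulate D v)
    t∈′ : true ∈ dominate (toℕ v) xs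
    t∈′ = true∈dominate (toℕ v) xs (toℕ<length-tabulate D v)
    und′ : undominated (dominate (toℕ v) xs) ≤ k
    und′ = s≤s⁻¹ (≤-trans (playable⇒undominated-< (toℕ v) 0 xs (trans (sym (playable-tabulate D v)) pv)) und≤)

-- The first move on the path

replicate-+ : ∀ m n → replicate (m + n) false ≡ replicate m false ++ replicate n false
replicate-+ zero    n = refl
replicate-+ (suc m) n = cong (false ∷_) (replicate-+ m n)

first-move-end : ∀ b → value (dominate 0 (replicate (2 + b) false)) ≡ residue b
first-move-end b = begin
  value (dominate 0 (replicate (2 + b) false))
    ≡⟨ value-move-window (replicate (2 + b) false) [] (replicate b false ∷ʳ true) refl ⟩
  value (replicate b false ∷ʳ true)
    ≡⟨ value-∷ʳ-true (replicate b false) ⟩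
  value (replicate b false)
    ≡⟨ value-replicate b ⟩
  residue b
    ∎

first-move-interior : ∀ a b → value (dominate (suc a) (replicate (a + (3 + b)) false)) ≡ residue a ⊕ residue b
first-move-interior a b = begin
  value (dominate (suc a) xs)               ≡⟨ cong (λ i → value (dominate (suc i) xs)) (length-replicate a) ⟨
  value (dominate (length pre) xs)          ≡⟨ value-move-window xs pre post split ⟩
  value (pre ++ true ∷ true ∷ true ∷ post)  ≡⟨ value-replicate-++-∷ a (true ∷ true ∷ post) ⟩
  residue a ⊕ value post                    ≡⟨ cong (residue a ⊕_) (value-∷ʳ-true (replicate b false)) ⟩
  residue a ⊕ value (replicate b false)     ≡⟨ cong (residue a ⊕_) (value-replicate b) ⟩
  residue a ⊕ residue b                     ∎
  where
  xs pre post : List Bool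
  xs = replicate (a + (3 + b)) false
  pre = true ∷ replicate a false
  post = replicate b false ∷ʳ true
  split : pad xs ≡ pre ++ false ∷ false ∷ false ∷ post
  split = cong (true ∷_) (trans (cong (_∷ʳ true) (replicate-+ a (3 + b))) (++-assoc (replicate a false) _ _))

first-move-last : ∀ a → value (dominate (suc a) (replicate (a + 2) false)) ≡ residue a
first-move-last a = begin
  value (dominate (suc a) xs)               ≡⟨ cong (λ i → value (dominate (suc i) xs)) (length-replicate a) ⟨
  value (dominate (length pre) xs)          ≡⟨ value-move-window xs pre [] split ⟩
  value (pre ++ true ∷ true ∷ true ∷ [])    ≡⟨ value-replicate-++-∷ a (true ∷ true ∷ []) ⟩
  residue a ⊕ 0F                            ≡⟨ ⊕-identityʳ (residue a) ⟩
  residue a                                 ∎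
  where
  xs pre : List Bool
  xs = replicate (a + 2) false
  pre = true ∷ replicate a false
  split : pad xs ≡ pre ++ false ∷ false ∷ true ∷ []
  split = cong (true ∷_) (trans (cong (_∷ʳ true) (replicate-+ a 2)) (++-assoc (replicate a false) _ _))

FirstMoveValue : ℕ → ℕ → Set
FirstMoveValue n j =
  (∃[ b ] n ≡ 2 + b × value (dominate j (replicate n false)) ≡ residue b) ⊎
  (∃[ a ] ∃[ b ] n ≡ a + (3 + b) × value (dominate j (replicate n false)) ≡ residue a ⊕ residue b)

first-move-value : ∀ n j → j < 2 + n → FirstMoveValue (2 + n) j
first-move-value n zero    _           = inj₁ (n , refl , first-move-end n)
first-move-value n (suc a) (s≤s a<n+1) with m≤n⇒∃[o]m+o≡n (s≤s⁻¹ a<n+1)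
... | o , refl = subst (λ k → FirstMoveValue k (suc a)) (trans (+-suc a (suc o)) (cong suc (+-suc a o))) (after o)
  where
  after : ∀ o → FirstMoveValue (a + (2 + o)) (suc a)
  after zero    = inj₁ (a , +-comm a 2 , first-move-last a)
  after (suc b) = inj₂ (a , b , refl , first-move-interior a b)

first-move-nimber : ∀ k (v : Fin (suc k)) → playable start v ≡ true →
  nimberFuel k (play start v) ≡ toℕ (value (dominate (toℕ v) (replicate (suc k) false)))
first-move-nimber k v pv =
  trans (option-nimber k start v inv und≤ pv)
        (cong (λ xs → toℕ (value (dominate (toℕ v) xs))) (tabulate-start (suc k)))
  where
  tabulate-start : ∀ n → tabulate (start {n}) ≡ replicate n false
  tabulate-start zero    = refl
  tabulate-start (suc n) = cong (false ∷_) (tabulate-start n)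
  undominated-replicate : ∀ n → undominated (replicate n false) ≡ n
  undominated-replicate zero    = refl
  undominated-replicate (suc n) = cong suc (undominated-replicate n)
  inv : NoIsolated (pad (tabulate (start {suc k})))
  inv = subst (NoIsolated ∘ pad) (sym (tabulate-start (suc k))) (NoIsolated-start (suc k))
  und≤ : undominated (tabulate (start {suc k})) ≤ suc k
  und≤ = subst ((_≤ suc k) ∘ undominated) (sym (tabulate-start (suc k))) (≤-reflexive (undominated-replicate (suc k)))

pathNimber : Fin 4 → Fin 4
pathNimber 0F = 0F
pathNimber 1F = 1F
pathNimber 2F = 1F
pathNimber 3F = 3F

end-option-≢ : ∀ y → y ≢ pathNimber (2F +₄ y)
end-option-≢ = from-yes (all? λ y → ¬? (y ≟ pathNimber (2F +₄ y)))

interior-option-≢ : ∀ x y → x ⊕ y ≢ pathNimber (x +₄ (3F +₄ y))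
interior-option-≢ = from-yes (all? λ x → all? λ y → ¬? (x ⊕ y ≟ pathNimber (x +₄ (3F +₄ y))))

below-pathNimber : ∀ s t → t <ᶠ pathNimber s → t ≡ 1F +₄ s ⊎ t ≡ 1F ⊕ s ⊎ t ≡ 2F +₄ s
below-pathNimber = from-yes (all? λ s → all? λ t →
  t <? pathNimber s →-dec (t ≟ 1F +₄ s ⊎-dec t ≟ 1F ⊕ s ⊎-dec t ≟ 2F +₄ s))

first-move-≢ : ∀ m j → j < 4 + m → value (dominate j (replicate (4 + m) false)) ≢ pathNimber (residue m)
first-move-≢ m j j<n same with first-move-value (2 + m) j j<n
... | inj₁ (b , n≡ , value-b) =
  end-option-≢ (residue b) (trans (sym value-b) (trans same (cong pathNimber (trans (cong residue n≡) (residue-+ 2 b)))))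
... | inj₂ (a , b , n≡ , value-ab) =
  interior-option-≢ (residue a) (residue b) (trans (sym value-ab) (trans same (cong pathNimber (begin
    residue (4 + m)                   ≡⟨ cong residue n≡ ⟩
    residue (a + (3 + b))             ≡⟨ residue-+ a (3 + b) ⟩
    residue a +₄ residue (3 + b)      ≡⟨ cong (residue a +₄_) (residue-+ 3 b) ⟩
    residue a +₄ (3F +₄ residue b)    ∎))))

nimberPath-4+ : ∀ m → nimberPath (4 + m) ≡ toℕ (pathNimber (residue m))
nimberPath-4+ m = nimberFuel-suc-mex (3 + m) start (toℕ (pathNimber (residue m))) fresh reached
  where
  Reached : ℕ → Set
  Reached j = ∃[ v ] playable start v ≡ true × nimberFuel (3 + m) (play start v) ≡ j
  fresh : ∀ v → playable start v ≡ true → nimberFuel (3 + m) (play start v) ≢ toℕ (pathNimber (residue m))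
  fresh v pv same = first-move-≢ m (toℕ v) (toℕ<n v) (toℕ-injective (trans (sym (first-move-nimber (3 + m) v pv)) same))
  reach : ∀ {j} v t → playable start v ≡ true → value (dominate (toℕ v) (replicate (4 + m) false)) ≡ t →
          toℕ t ≡ j → Reached j
  reach v t pv value-v toℕ-t = v , pv , trans (first-move-nimber (3 + m) v pv) (trans (cong toℕ value-v) toℕ-t)
  choose : ∀ {j} t → toℕ t ≡ j →
           t ≡ 1F +₄ residue m ⊎ t ≡ 1F ⊕ residue m ⊎ t ≡ 2F +₄ residue m → Reached j
  choose t toℕ-t (inj₁ refl)        = reach 1F t refl (trans (first-move-interior 0 (1 + m)) (residue-suc m)) toℕ-t
  choose t toℕ-t (inj₂ (inj₁ refl)) = reach 2F t refl (first-move-interior 1 m) toℕ-t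
  choose t toℕ-t (inj₂ (inj₂ refl)) = reach 0F t refl (trans (first-move-end (2 + m)) (residue-+ 2 m)) toℕ-t
  reached : ∀ j → j < toℕ (pathNimber (residue m)) → Reached j
  reached j j<g = let t , toℕ-t , t<g = below-toℕ (pathNimber (residue m)) j j<g
                  in choose t toℕ-t (below-pathNimber (residue m) t t<g)

residue-% : ∀ n → toℕ (residue n) ≡ n % 4
residue-% 0 = refl
residue-% 1 = refl
residue-% 2 = refl
residue-% 3 = refl
residue-% (suc (suc (suc (suc n)))) = residue-% n

pathNimber-zero : ∀ s → toℕ (pathNimber s) ≡ 0 → s ≡ 0F
pathNimber-zero = from-yes (all? λ s → toℕ (pathNimber s) ℕ.≟ 0 →-dec s ≟ 0F)

nimberPath-mod-4 : ∀ n → 4 ≤ n → (r : Fin 4) → n % 4 ≡ toℕ r → nimberPath n ≡ toℕ (pathNimber r)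
nimberPath-mod-4 _ (s≤s (s≤s (s≤s (s≤s {n = m} _)))) r m%4 =
  trans (nimberPath-4+ m) (cong (toℕ ∘ pathNimber) (toℕ-injective (trans (residue-% m) m%4)))

BobWins⇔4∣ : ∀ n → BobWins n ⇔ 4 ∣ n
BobWins⇔4∣ 0 = mk⇔ (λ _ → 4 ∣0) (λ _ → refl)
BobWins⇔4∣ 1 = mk⇔ (λ ()) ((λ ()) ∘ n∣m⇒m%n≡0 1 4)
BobWins⇔4∣ 2 = mk⇔ (λ ()) ((λ ()) ∘ n∣m⇒m%n≡0 2 4)
BobWins⇔4∣ 3 = mk⇔ (λ ()) ((λ ()) ∘ n∣m⇒m%n≡0 3 4)
BobWins⇔4∣ n@(suc (suc (suc (suc m)))) = mk⇔
  (λ nimber≡0 → m%n≡0⇒n∣m n 4 (trans (sym (residue-% m))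
                  (cong toℕ (pathNimber-zero (residue m) (trans (sym (nimberPath-4+ m)) nimber≡0)))))
  (λ 4∣n → nimberPath-mod-4 n (s≤s (s≤s (s≤s (s≤s z≤n)))) 0F (n∣m⇒m%n≡0 n 4 4∣n))

theorem3 : (nimberPath 1 ≡ 1 × nimberPath 2 ≡ 1 × nimberPath 3 ≡ 2)
    × (∀ (n : ℕ) → 4 ≤ n →
         (n % 4 ≡ 0 → nimberPath n ≡ 0) × (n % 4 ≡ 1 → nimberPath n ≡ 1)
         × (n % 4 ≡ 2 → nimberPath n ≡ 1) × (n % 4 ≡ 3 → nimberPath n ≡ 3))
    × (∀ (n : ℕ) → BobWins n ⇔ (4 ∣ n))
theorem3 =
  (refl , refl , refl) ,
  (λ n 4≤n → nimberPath-mod-4 n 4≤n 0F , nimberPath-mod-4 n 4≤n 1F ,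
             nimberPath-mod-4 n 4≤n 2F , nimberPath-mod-4 n 4≤n 3F) ,
  BobWins⇔4∣
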